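{- Let $A$ be a set with a partial ordering $\preccurlyeq$, and let $U(A)\subseteq 2^A$ be the set of up-sets of $A$, with the topology induced by the natural topology on $2^A$. For $x\in U(A)$ the following are equivalent: (i) $x$ is an isolated point of $U(A)$, i.e. $x$ is not in the closure of $U(A)-\{x\}$; (ii) $x$ is both the union of a finite (possibly empty) family of principal up-sets and the intersection of a finite (possibly empty) family of complements of principal down-sets.
   Context: An up-set of $A$ is a subset $x$ with $a\in x$, $b\succcurlyeq a\Rightarrow b\in x$. For $a\in A$, the principal up-set is ${\uparrow}(a)=\{b\mid b\succcurlyeq a\}$ and the principal down-set is ${\downarrow}(a)=\{b\mid b\preccurlyeq a\}$. The natural topology on $2^A$ is the product topology of discrete copies of $\{0,1\}$, with subbasis the sets $\{x\mid a\in x\}$ and $\{x\mid a\notin x\}$ for $a\in A$. The empty union is $\emptyset$ and the empty intersection is $A$. -}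

module Defs where

open import Level using (Level; _⊔_)
open import Data.Bool using (Bool; true; false)
open import Data.List using (List)
open import Data.List.Relation.Unary.All using (All)
open import Data.List.Relation.Unary.Any using (Any)
open import Data.Product using (Σ; ∃; _×_)
open import Relation.Nullary using (¬_)
open import Relation.Binary.PropositionalEquality using (_≡_)
open import Relation.Binary.Structures using (IsPartialOrder)
open import Function.Bundles using (_⇔_)

Sub : ∀ {a} → Set a → Set a
Sub A = A → Bool

module _ {a ℓ} {A : Set a} (_≼_ : A → A → Set ℓ) where

  IsUpSet : Sub A → Set (a ⊔ ℓ)
  IsUpSet x = ∀ {p q} → x p ≡ true → p ≼ q → x q ≡ true

  IsUnionOfPrincipalUp : Sub A → List A → Set (a ⊔ ℓ)
  IsUnionOfPrincipalUp x as = ∀ b → (x b ≡ true) ⇔ Any (λ c → c ≼ b) as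

  IsInterOfComplPrincipalDown : Sub A → List A → Set (a ⊔ ℓ)
  IsInterOfComplPrincipalDown x bs = ∀ c → (x c ≡ true) ⇔ All (λ b → ¬ (c ≼ b)) bs

-- Basic open set of the product topology on 2^A, given by finitely many
-- subbasic conditions: p ∈ y for p in P, and q ∉ y for q in N.
InBasic : ∀ {a} {A : Set a} → List A → List A → Sub A → Set a
InBasic P N y = All (λ p → y p ≡ true) P × All (λ q → y q ≡ false) N

_≐_ : ∀ {a} {A : Set a} → Sub A → Sub A → Set a
x ≐ y = ∀ p → x p ≡ y p

module _ {a ℓ} {A : Set a} (_≼_ : A → A → Set ℓ) where

  -- x is isolated in U(A): x is not in the closure of U(A) - {x}, i.e.
  -- some basic open neighbourhood of x meets no up-set other than x.
  IsolatedInUpSets : Sub A → Set (a ⊔ ℓ)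
  IsolatedInUpSets x =
    Σ (List A) λ P → Σ (List A) λ N →
      InBasic P N x ×
      ¬ (Σ (Sub A) λ y → IsUpSet _≼_ y × InBasic P N y × ¬ (y ≐ x))

-- An up-set y in a basic neighbourhood {y | P ⊆ y, N ∩ y = ∅} satisfies
-- ↑P ⊆ y ⊆ A - ↓N.  Hence if x = ↑P = A - ↓N, the neighbourhood given by P
-- and N contains no up-set but x.  Conversely, if the neighbourhood (P, N)
-- isolates x, then ↑P and A - ↓N are up-sets lying in it, so both equal x.
module Submission where

open import Defs
open import Level using (_⊔_)
open import Data.Bool using (Bool; true; false)
open import Data.Bool.Properties using (_≟_; ¬-not; not-¬)
open import Data.List using (List; []; _∷_)
open import Data.List.Relation.Unary.All as All using (All; []; _∷_)
open import Data.List.Relation.Unary.Any as Any using (Any; here; there)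
open import Data.Product using (Σ; _×_; _,_)
open import Relation.Nullary using (¬_; yes; no; does; contradiction)
open import Relation.Nullary.Decidable using (decidable-stable)
open import Relation.Binary.PropositionalEquality using (_≡_; refl; sym; trans)
open import Relation.Binary.Structures using (IsPreorder; IsPartialOrder)
open import Function.Bundles using (_⇔_; mk⇔; Equivalence)
open import Axiom.ExcludedMiddle using (ExcludedMiddle)

open Equivalence using (to; from)

Represents : ∀ {a p} {A : Set a} → Sub A → (A → Set p) → Set (a ⊔ p)
Represents x Q = ∀ b → (x b ≡ true) ⇔ Q b

≐-stable : ∀ {a} {A : Set a} {x y : Sub A} → ¬ ¬ (x ≐ y) → x ≐ y
≐-stable {x = x} {y} ¬¬x≐y p =
  decidable-stable (x p ≟ y p) (λ x≢y → ¬¬x≐y (λ x≐y → x≢y (x≐y p)))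

≡-from-≡true⇔ : ∀ {b c : Bool} → (b ≡ true → c ≡ true) → (c ≡ true → b ≡ true) → b ≡ c
≡-from-≡true⇔ {true}  b⇒c _ = sym (b⇒c refl)
≡-from-≡true⇔ {false} {true}  _ c⇒b = c⇒b refl
≡-from-≡true⇔ {false} {false} _ _ = refl

represents-resp-≐ : ∀ {a p} {A : Set a} {x y : Sub A} {Q : A → Set p} →
                    x ≐ y → Represents x Q → Represents y Q
represents-resp-≐ x≐y x~Q b =
  mk⇔ (λ yb → to (x~Q b) (trans (x≐y b) yb))
      (λ qb → trans (sym (x≐y b)) (from (x~Q b) qb))

module _ {a} {A : Set a} where

  ⟦_⟧ : ∀ {p} → (A → Set p) → ExcludedMiddle p → Sub A
  ⟦ Q ⟧ em b = does (em {Q b})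

  ⟦⟧-represents : ∀ {p} (Q : A → Set p) (em : ExcludedMiddle p) → Represents (⟦ Q ⟧ em) Q
  ⟦⟧-represents Q em b with em {Q b}
  ... | yes qb = mk⇔ (λ _ → qb) (λ _ → refl)
  ... | no ¬qb = mk⇔ (λ ()) (λ qb → contradiction qb ¬qb)

module _ {a ℓ} {A : Set a} {_≼_ : A → A → Set ℓ} (pre : IsPreorder _≡_ _≼_) where
  open IsPreorder pre using () renaming (refl to ≼-refl; trans to ≼-trans)

  UpClosed : ∀ {p} → (A → Set p) → Set (a ⊔ ℓ ⊔ p)
  UpClosed Q = ∀ {p q} → Q p → p ≼ q → Q q

  PrincipalUpUnion : List A → A → Set (a ⊔ ℓ)
  PrincipalUpUnion P b = Any (λ c → c ≼ b) P

  PrincipalDownComplInter : List A → A → Set (a ⊔ ℓ)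
  PrincipalDownComplInter N c = All (λ b → ¬ (c ≼ b)) N

  principalUpUnion-upClosed : ∀ P → UpClosed (PrincipalUpUnion P)
  principalUpUnion-upClosed P c∈↑P c≼d = Any.map (λ e≼c → ≼-trans e≼c c≼d) c∈↑P

  principalDownComplInter-upClosed : ∀ N → UpClosed (PrincipalDownComplInter N)
  principalDownComplInter-upClosed N c∉↓N c≼d = All.map (λ d⋠b c≼b → d⋠b (≼-trans c≼d c≼b)) c∉↓N

  principalUpUnion-⊇ : ∀ P → All (PrincipalUpUnion P) P
  principalUpUnion-⊇ []      = []
  principalUpUnion-⊇ (p ∷ P) = here ≼-refl ∷ All.map there (principalUpUnion-⊇ P)

  principalDownComplInter-disjoint : ∀ N → All (λ q → ¬ PrincipalDownComplInter N q) N
  principalDownComplInter-disjoint []      = []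
  principalDownComplInter-disjoint (q ∷ N) =
    (λ { (q⋠q ∷ _) → q⋠q ≼-refl }) ∷
    All.map (λ q∈↓N → λ { (_ ∷ ∉↓N) → q∈↓N ∉↓N }) (principalDownComplInter-disjoint N)

  represents-upClosed⇒upSet : ∀ {p} {x : Sub A} {Q : A → Set p} →
                              Represents x Q → UpClosed Q → IsUpSet _≼_ x
  represents-upClosed⇒upSet x~Q Q-up {p} {q} xp p≼q =
    from (x~Q q) (Q-up (to (x~Q p) xp) p≼q)

  upSet-⊇-principalUpUnion : ∀ {y : Sub A} {P} → IsUpSet _≼_ y →
                             All (λ p → y p ≡ true) P → ∀ {b} → PrincipalUpUnion P b → y b ≡ true
  upSet-⊇-principalUpUnion y-up (yp ∷ _)   (here p≼b)  = y-up yp p≼b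
  upSet-⊇-principalUpUnion y-up (_  ∷ yP)  (there c∈↑P) = upSet-⊇-principalUpUnion y-up yP c∈↑P

  upSet-⊆-principalDownComplInter : ∀ {y : Sub A} {N} → IsUpSet _≼_ y →
                                    All (λ q → y q ≡ false) N →
                                    ∀ {c} → y c ≡ true → PrincipalDownComplInter N c
  upSet-⊆-principalDownComplInter y-up yN yc =
    All.map (λ yq≡false c≼q → not-¬ yq≡false (y-up yc c≼q)) yN

  represents-⊇ : ∀ {p} {x : Sub A} {Q : A → Set p} {P} → Represents x Q →
                 All Q P → All (λ p → x p ≡ true) P
  represents-⊇ x~Q = All.map (λ {p} → from (x~Q p))

  represents-disjoint : ∀ {p} {x : Sub A} {Q : A → Set p} {N} → Represents x Q →
                        All (λ q → ¬ Q q) N → All (λ q → x q ≡ false) N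
  represents-disjoint x~Q = All.map (λ {q} ¬Qq → ¬-not (λ xq → ¬Qq (to (x~Q q) xq)))

  isolated⇒finitelyPresented : ∀ {x : Sub A} → ExcludedMiddle (a ⊔ ℓ) → IsUpSet _≼_ x →
    IsolatedInUpSets _≼_ x →
    (Σ (List A) λ as → IsUnionOfPrincipalUp _≼_ x as) ×
    (Σ (List A) λ bs → IsInterOfComplPrincipalDown _≼_ x bs)
  isolated⇒finitelyPresented {x} em x-up (P , N , (xP , xN) , isolating) =
      (P , representedInNbhd (PrincipalUpUnion P) (principalUpUnion-upClosed P)
             (principalUpUnion-⊇ P)
             (All.map (λ xq≡false q∈↑P →
                         not-¬ xq≡false (upSet-⊇-principalUpUnion x-up xP q∈↑P)) xN))
    , (N , representedInNbhd (PrincipalDownComplInter N) (principalDownComplInter-upClosed N)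
             (All.map (upSet-⊆-principalDownComplInter x-up xN) xP)
             (principalDownComplInter-disjoint N))
    where
    representedInNbhd : (Q : A → Set (a ⊔ ℓ)) → UpClosed Q →
                        All Q P → All (λ q → ¬ Q q) N → Represents x Q
    representedInNbhd Q Q-up QP ¬QN = represents-resp-≐ y≐x y~Q
      where
      y~Q : Represents (⟦ Q ⟧ em) Q
      y~Q = ⟦⟧-represents Q em

      y≐x : ⟦ Q ⟧ em ≐ x
      y≐x = ≐-stable (λ y≉x → isolating
        (⟦ Q ⟧ em , represents-upClosed⇒upSet y~Q Q-up ,
         (represents-⊇ y~Q QP , represents-disjoint y~Q ¬QN) , y≉x))

  finitelyPresented⇒isolated : ∀ {x : Sub A} →
    (Σ (List A) λ as → IsUnionOfPrincipalUp _≼_ x as) ×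
    (Σ (List A) λ bs → IsInterOfComplPrincipalDown _≼_ x bs) →
    IsolatedInUpSets _≼_ x
  finitelyPresented⇒isolated {x} ((P , x~↑P) , (N , x~↓Nᶜ)) =
    P , N , xInNbhd , λ (y , y-up , yInNbhd , y≉x) → y≉x (onlyUpSet y-up yInNbhd)
    where
    xInNbhd : InBasic P N x
    xInNbhd = represents-⊇ x~↑P (principalUpUnion-⊇ P) ,
              represents-disjoint x~↓Nᶜ (principalDownComplInter-disjoint N)

    onlyUpSet : ∀ {y} → IsUpSet _≼_ y → InBasic P N y → y ≐ x
    onlyUpSet y-up (yP , yN) b =
      ≡-from-≡true⇔ (λ yb → from (x~↓Nᶜ b) (upSet-⊆-principalDownComplInter y-up yN yb))
                    (λ xb → upSet-⊇-principalUpUnion y-up yP (to (x~↑P b) xb))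

lemma5p1 : ∀ {a ℓ} → ExcludedMiddle (Level._⊔_ a ℓ) →
    {A : Set a} (_≼_ : A → A → Set ℓ) → IsPartialOrder _≡_ _≼_ →
    (x : Sub A) → IsUpSet _≼_ x →
    IsolatedInUpSets _≼_ x ⇔
      ((Σ (List A) λ as → IsUnionOfPrincipalUp _≼_ x as) ×
       (Σ (List A) λ bs → IsInterOfComplPrincipalDown _≼_ x bs))
lemma5p1 em _≼_ po x x-up =
  mk⇔ (isolated⇒finitelyPresented isPreorder em x-up) (finitelyPresented⇒isolated isPreorder)
  where open IsPartialOrder po using (isPreorder)
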